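{- Let $p(x)=a_0+a_1x+\dots+a_mx^m$ be a polynomial of degree $m$ over a field $F$ of characteristic zero, and let $a_{k,n}$ denote the entries of the binomial array $B(p(x))$. Fix integers $n>0$ and $k>m$. Then (1) $a_{k,1}+a_{k,2}+\dots+a_{k,n}=a_{k+1,n+1}$; (2) $a_{k,n}-a_{k+1,n}+a_{k+2,n}-\dots+(-1)^{m+n-k}a_{m+n,n}=a_{k-1,n-1}$, i.e. $\sum_{j=k}^{m+n}(-1)^{j-k}a_{j,n}=a_{k-1,n-1}$.
   Context: For a sequence $(a_i)_{i\ge0}$ with generating function $p(x)=\sum_i a_ix^i$, the binomial array $B(p(x))$ has entries $a_{k,n}$ ($k\ge 0$ row index, $n\in\mathbb{Z}$ column index) equal to the coefficient of $x^k$ in $(1+x)^np(x)$ (for $n<0$, $(1+x)^n$ is the inverse power series). Equivalently $a_{k,0}=a_k$, $a_{0,n}=a_0$, and $a_{k,n+1}=a_{k-1,n}+a_{k,n}$, with entries of negative row index equal to $0$. -}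

module Defs where

import Algebra.Bundles
open import Algebra.Bundles using (CommutativeRing)
open import Data.Nat using (ℕ; zero; suc; _∸_; _<?_)
open import Data.Fin using (Fin; fromℕ<)
open import Data.Product using (_×_; ∃)
import Level
open import Relation.Nullary using (¬_; yes; no)
import Algebra.Definitions.RawSemiring as RS

module _ {c ℓ} (R : CommutativeRing c ℓ) where
  open CommutativeRing R
  open RS (Algebra.Bundles.Semiring.rawSemiring semiring) using () renaming (_×_ to _·ₙ_)

  IsField : Set (c Level.⊔ ℓ)
  IsField = (¬ (1# ≈ 0#)) × (∀ x → ¬ (x ≈ 0#) → ∃ λ y → x * y ≈ 1#)

  CharZero : Set ℓ
  CharZero = ∀ n → ¬ (suc n ·ₙ 1# ≈ 0#)

  pow : Carrier → ℕ → Carrier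
  pow = RS._^_ (Algebra.Bundles.Semiring.rawSemiring semiring)

  Series : Set c
  Series = ℕ → Carrier

  sumTo : ℕ → (ℕ → Carrier) → Carrier
  sumTo zero f = 0#
  sumTo (suc n) f = sumTo n f + f n

  mulS : Series → Series → Series
  mulS f g k = sumTo (suc k) (λ i → f i * g (k ∸ i))

  onePlusX : Series
  onePlusX zero = 1#
  onePlusX (suc zero) = 1#
  onePlusX (suc (suc _)) = 0#

  powS : Series → ℕ → Series
  powS f zero zero = 1#
  powS f zero (suc _) = 0#
  powS f (suc n) = mulS f (powS f n)

  polyCoeff : (m : ℕ) → (Fin (suc m) → Carrier) → Series
  polyCoeff m a i with i <? suc m
  ... | yes i<m+1 = a (fromℕ< i<m+1)
  ... | no _ = 0#

  -- entry a_{k,n} (n ≥ 0) of the binomial array B(p(x)):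
  -- the coefficient of x^k in (1+x)^n p(x)
  binArr : (m : ℕ) → (Fin (suc m) → Carrier) → ℕ → ℕ → Carrier
  binArr m a k n = mulS (powS onePlusX n) (polyCoeff m a) k

module Submission where

open import Defs
open import Algebra.Bundles using (CommutativeRing)
open import Data.Nat using (ℕ; suc; _+_; _∸_; _<_)
open import Data.Fin using (Fin; fromℕ)
open import Data.Product using (_×_)
open import Relation.Nullary using (¬_)

open import Data.Nat using (zero; _≤_; _<?_; s≤s)
import Data.Nat.Properties as ℕ
open import Data.Product using (_,_)
open import Data.Empty using (⊥-elim)
open import Function using (_∘_)
open import Relation.Nullary using (yes; no)
import Relation.Binary.PropositionalEquality as ≡

-- The whole argument is Pascal's rule a_{k,n+1} = a_{k,n} + a_{k-1,n}, telescoped along a row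
-- for (1) and along a column with alternating signs for (2), together with the vanishing of
-- a_{k,n} for k > m + n, which kills the boundary term of each telescope. Neither the field
-- structure, nor the characteristic, nor the leading coefficient plays any role.

module BinomialArray {c ℓ} (R : CommutativeRing c ℓ) where
  open CommutativeRing R renaming (_+_ to _⊕_)
  open import Algebra.Properties.CommutativeSemigroup +-commutativeSemigroup
    using (interchange; xy∙z≈xz∙y)
  open import Algebra.Properties.Ring ring using (-1*x≈-x)
  open import Relation.Binary.Reasoning.Setoid setoid

  ∑ : ℕ → (ℕ → Carrier) → Carrier
  ∑ = sumTo R

  ∑-cong : ∀ n {f g : ℕ → Carrier} → (∀ i → f i ≈ g i) → ∑ n f ≈ ∑ n g
  ∑-cong zero    f≈g = refl
  ∑-cong (suc n) f≈g = +-cong (∑-cong n f≈g) (f≈g n)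

  ∑-zero : ∀ n {f : ℕ → Carrier} → (∀ i → f i ≈ 0#) → ∑ n f ≈ 0#
  ∑-zero zero    f≈0 = refl
  ∑-zero (suc n) f≈0 = trans (+-cong (∑-zero n f≈0) (f≈0 n)) (+-identityˡ 0#)

  ∑-distrib-⊕ : ∀ n (f g : ℕ → Carrier) → ∑ n (λ i → f i ⊕ g i) ≈ ∑ n f ⊕ ∑ n g
  ∑-distrib-⊕ zero    f g = sym (+-identityˡ 0#)
  ∑-distrib-⊕ (suc n) f g =
    trans (+-congʳ (∑-distrib-⊕ n f g)) (interchange (∑ n f) (∑ n g) (f n) (g n))

  ∑-unfoldˡ : ∀ n (f : ℕ → Carrier) → ∑ (suc n) f ≈ f 0 ⊕ ∑ n (f ∘ suc)
  ∑-unfoldˡ zero    f = trans (+-identityˡ _) (sym (+-identityʳ _))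
  ∑-unfoldˡ (suc n) f = trans (+-congʳ (∑-unfoldˡ n f)) (+-assoc _ _ _)

  ≈-dropʳ : ∀ {x y z} → y ≈ 0# → x ⊕ y ≈ z → x ≈ z
  ≈-dropʳ {x} y≈0 x⊕y≈z = trans (sym (trans (+-congˡ y≈0) (+-identityʳ x))) x⊕y≈z

  sign : ℕ → Carrier
  sign = pow R (- 1#)

  sign-cancel : ∀ j x → sign j * x ⊕ sign (suc j) * x ≈ 0#
  sign-cancel j x = begin
    sign j * x ⊕ (- 1# * sign j) * x  ≈⟨ +-congˡ (*-assoc _ _ _) ⟩
    sign j * x ⊕ - 1# * (sign j * x)  ≈⟨ +-congˡ (-1*x≈-x _) ⟩
    sign j * x ⊕ - (sign j * x)       ≈⟨ -‿inverseʳ _ ⟩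
    0#                                ∎

  mulS-onePlusX-zero : ∀ g → mulS R (onePlusX R) g 0 ≈ g 0
  mulS-onePlusX-zero g = trans (+-identityˡ _) (*-identityˡ _)

  mulS-onePlusX-suc : ∀ g j → mulS R (onePlusX R) g (suc j) ≈ g (suc j) ⊕ g j
  mulS-onePlusX-suc g j = begin
    mulS R (onePlusX R) g (suc j)
      ≈⟨ ∑-unfoldˡ (suc j) _ ⟩
    1# * g (suc j) ⊕ ∑ (suc j) (λ i → onePlusX R (suc i) * g (j ∸ i))
      ≈⟨ +-cong (*-identityˡ _) (∑-unfoldˡ j _) ⟩
    g (suc j) ⊕ (1# * g j ⊕ ∑ j (λ i → 0# * g (j ∸ suc i)))
      ≈⟨ +-congˡ (+-cong (*-identityˡ _) (∑-zero j (λ _ → zeroˡ _))) ⟩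
    g (suc j) ⊕ (g j ⊕ 0#)
      ≈⟨ +-congˡ (+-identityʳ _) ⟩
    g (suc j) ⊕ g j
      ∎

  binomial : ℕ → ℕ → Carrier
  binomial = powS R (onePlusX R)

  binomial-vanishes : ∀ n i → n < i → binomial n i ≈ 0#
  binomial-vanishes zero    (suc i) _           = refl
  binomial-vanishes (suc n) (suc i) (s≤s n<i) = begin
    binomial (suc n) (suc i)           ≈⟨ mulS-onePlusX-suc (binomial n) i ⟩
    binomial n (suc i) ⊕ binomial n i  ≈⟨ +-cong (binomial-vanishes n (suc i) (ℕ.m<n⇒m<1+n n<i))
                                                 (binomial-vanishes n i n<i) ⟩
    0# ⊕ 0#                            ≈⟨ +-identityˡ 0# ⟩
    0#                                 ∎

  module _ (m : ℕ) (a : Fin (suc m) → Carrier) where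
    p : ℕ → Carrier
    p = polyCoeff R m a

    B : ℕ → ℕ → Carrier
    B = binArr R m a

    polyCoeff-vanishes : ∀ j → m < j → p j ≈ 0#
    polyCoeff-vanishes j m<j with j <? suc m
    ... | yes j≤m = ⊥-elim (ℕ.<⇒≱ m<j (ℕ.≤-pred j≤m))
    ... | no _    = refl

    binArr-pascal : ∀ k n → B (suc k) (suc n) ≈ B (suc k) n ⊕ B k n
    binArr-pascal k n = begin
      B (suc k) (suc n)
        ≈⟨ ∑-unfoldˡ (suc k) _ ⟩
      binomial (suc n) 0 * p (suc k) ⊕ ∑ (suc k) (λ i → binomial (suc n) (suc i) * p (k ∸ i))
        ≈⟨ +-cong (*-congʳ (mulS-onePlusX-zero (binomial n)))
                  (∑-cong (suc k) (λ i → *-congʳ (mulS-onePlusX-suc (binomial n) i))) ⟩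
      binomial n 0 * p (suc k) ⊕ ∑ (suc k) (λ i → (binomial n (suc i) ⊕ binomial n i) * p (k ∸ i))
        ≈⟨ +-congˡ (trans (∑-cong (suc k) (λ i → distribʳ _ _ _)) (∑-distrib-⊕ (suc k) _ _)) ⟩
      binomial n 0 * p (suc k) ⊕ (∑ (suc k) (λ i → binomial n (suc i) * p (k ∸ i)) ⊕ B k n)
        ≈⟨ sym (+-assoc _ _ _) ⟩
      (binomial n 0 * p (suc k) ⊕ ∑ (suc k) (λ i → binomial n (suc i) * p (k ∸ i))) ⊕ B k n
        ≈⟨ +-congʳ (sym (∑-unfoldˡ (suc k) _)) ⟩
      B (suc k) n ⊕ B k n
        ∎

    -- Each term binomial n i * p (k ∸ i) has i > n or k ∸ i > m.
    binArr-vanishes : ∀ k n → m + n < k → B k n ≈ 0#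
    binArr-vanishes k n m+n<k = ∑-zero (suc k) term
      where
      term : ∀ i → binomial n i * p (k ∸ i) ≈ 0#
      term i with n <? i
      ... | yes n<i = trans (*-congʳ (binomial-vanishes n i n<i)) (zeroˡ _)
      ... | no n≮i  = trans (*-congˡ (polyCoeff-vanishes (k ∸ i) m<k∸i)) (zeroʳ _)
        where
        m+i<k : m + i < k
        m+i<k = ℕ.≤-<-trans (ℕ.+-monoʳ-≤ m (ℕ.≮⇒≥ n≮i)) m+n<k
        m<k∸i : m < k ∸ i
        m<k∸i = ≡.subst (_≤ k ∸ i) (ℕ.m+n∸n≡m (suc m) i) (ℕ.∸-monoˡ-≤ i m+i<k)

    binArr-row-sum : ∀ k n → ∑ n (λ i → B k (suc i)) ⊕ B (suc k) 1 ≈ B (suc k) (suc n)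
    binArr-row-sum k zero    = +-identityˡ _
    binArr-row-sum k (suc n) = begin
      (∑ n (λ i → B k (suc i)) ⊕ B k (suc n)) ⊕ B (suc k) 1  ≈⟨ xy∙z≈xz∙y _ _ _ ⟩
      (∑ n (λ i → B k (suc i)) ⊕ B (suc k) 1) ⊕ B k (suc n)  ≈⟨ +-congʳ (binArr-row-sum k n) ⟩
      B (suc k) (suc n) ⊕ B k (suc n)                        ≈⟨ sym (binArr-pascal k (suc n)) ⟩
      B (suc k) (suc (suc n))                                ∎

    binArr-alternating-sum : ∀ k n t →
      ∑ t (λ j → sign j * B (suc k + j) (suc n)) ⊕ sign t * B (k + t) n ≈ B k n
    binArr-alternating-sum k n zero =
      trans (+-identityˡ _) (trans (*-identityˡ _) (reflexive (≡.cong (λ j → B j n) (ℕ.+-identityʳ k))))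
    binArr-alternating-sum k n (suc t) = begin
      (S ⊕ sign t * B (suc k + t) (suc n)) ⊕ sign (suc t) * B (k + suc t) n
        ≈⟨ +-cong (+-congˡ (*-congˡ (binArr-pascal (k + t) n)))
                  (*-congˡ (reflexive (≡.cong (λ j → B j n) (ℕ.+-suc k t)))) ⟩
      (S ⊕ sign t * (X ⊕ Y)) ⊕ sign (suc t) * X
        ≈⟨ +-congʳ (+-congˡ (trans (distribˡ _ _ _) (+-comm _ _))) ⟩
      (S ⊕ (sign t * Y ⊕ sign t * X)) ⊕ sign (suc t) * X
        ≈⟨ trans (+-congʳ (sym (+-assoc _ _ _))) (+-assoc _ _ _) ⟩
      (S ⊕ sign t * Y) ⊕ (sign t * X ⊕ sign (suc t) * X)
        ≈⟨ trans (+-congˡ (sign-cancel t X)) (+-identityʳ _) ⟩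
      S ⊕ sign t * Y
        ≈⟨ binArr-alternating-sum k n t ⟩
      B k n
        ∎
      where
      S X Y : Carrier
      S = ∑ t (λ j → sign j * B (suc k + j) (suc n))
      X = B (suc (k + t)) n
      Y = B (k + t) n

open BinomialArray

proposition4p2 : ∀ {c ℓ} (F : CommutativeRing c ℓ) → IsField F → CharZero F →
    let open CommutativeRing F renaming (_+_ to _+ᶠ_) in
    (m : ℕ) (a : Fin (suc m) → Carrier) → ¬ (a (fromℕ m) ≈ 0#) →
    (n k : ℕ) → 0 < n → m < k →
    (sumTo F n (λ i → binArr F m a k (suc i)) ≈ binArr F m a (suc k) (suc n))
    × (sumTo F (suc (m + n) ∸ k) (λ j → pow F (- 1#) j * binArr F m a (k + j) n)
    ≈ binArr F m a (k ∸ 1) (n ∸ 1))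
proposition4p2 F _ _ m a _ (suc n) (suc k) _ m<k =
    ≈-dropʳ F (binArr-vanishes F m a (suc (suc k)) 1 m+1<k+2) (binArr-row-sum F m a (suc k) (suc n))
  , ≈-dropʳ F last-vanishes (binArr-alternating-sum F m a k n t)
  where
  open CommutativeRing F using (_≈_; _*_; 0#; trans; *-congˡ; zeroʳ)
  t : ℕ
  t = suc (m + suc n) ∸ suc k
  m+1<k+2 : m + 1 < suc (suc k)
  m+1<k+2 = ≡.subst (_< suc (suc k)) (ℕ.+-comm 1 m) (s≤s m<k)
  m+n<k+t : m + n < k + t
  m+n<k+t = ℕ.<-≤-trans (ℕ.+-monoʳ-< m ℕ.≤-refl) (ℕ.m≤n+m∸n (m + suc n) k)
  last-vanishes : sign F t * binArr F m a (k + t) n ≈ 0#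
  last-vanishes = trans (*-congˡ (binArr-vanishes F m a (k + t) n m+n<k+t)) (zeroʳ _)
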